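{- Fix $n\ge1$. Let $g(k)$ (respectively $G(k)$) be the number of rational points of denominator $k$ in $(0,1]^n$ (respectively in $[0,1]^n$), and let $t(k)=g(1)+\cdots+g(k)$ and $T(k)=G(1)+\cdots+G(k)$. Then $$\lim_{k\to\infty}\frac{g(k+1)}{t(k)}=0,\qquad \lim_{k\to\infty}\frac{G(k+1)}{T(k)}=0,\qquad \lim_{k\to\infty}\frac{g(k)}{G(k)}=1.$$
   Context: Every $u\in\mathbb{Q}^n$ can be written uniquely as $u=(a_1/k,\ldots,a_n/k)$ with $a_1,\ldots,a_n,k$ integers, $k\ge1$, and $\gcd(a_1,\ldots,a_n,k)=1$; then $k$ is the denominator of $u$. -}

module Defs where

open import Data.Nat as ℕ using (ℕ; zero; suc; _≤_)
open import Data.Nat.GCD using (gcd)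
open import Data.List using (List; []; _∷_; [_]; map; concatMap; filter; length; upTo)
open import Data.Vec using (Vec; []; _∷_; foldr)
open import Data.Integer using (+_)
open import Data.Rational using (ℚ; _/_; 0ℚ; _-_; ∣_∣; _<_)
open import Data.Product using (∃)
open import Relation.Binary.PropositionalEquality using (_≡_)
open import Relation.Nullary.Decidable using (Dec)

tuples : (n : ℕ) → List ℕ → List (Vec ℕ n)
tuples zero r = [ [] ]
tuples (suc n) r = concatMap (λ a → map (a ∷_) (tuples n r)) r

gcdV : {n : ℕ} → Vec ℕ n → ℕ → ℕ
gcdV v k = foldr (λ _ → ℕ) gcd k v

-- number of tuples a with entries in r and gcd(a₁,…,aₙ,k) = 1,
-- i.e. number of rational points (a₁/k,…,aₙ/k) of denominator exactly k
countDen : (n : ℕ) → List ℕ → ℕ → ℕ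
countDen n r k = length (filter (λ v → gcdV v k ℕ.≟ 1) (tuples n r))

g : ℕ → ℕ → ℕ
g n k = countDen n (map suc (upTo k)) k

G : ℕ → ℕ → ℕ
G n k = countDen n (upTo (suc k)) k

t : ℕ → ℕ → ℕ
t n zero = 0
t n (suc k) = t n k ℕ.+ g n (suc k)

T : ℕ → ℕ → ℕ
T n zero = 0
T n (suc k) = T n k ℕ.+ G n (suc k)

-- a / b as a rational; the b = 0 case never arises for k ≥ 1 (convention 0)
frac : ℕ → ℕ → ℚ
frac a zero = 0ℚ
frac a (suc b) = (+ a) / suc b

Tendsto : (ℕ → ℚ) → ℚ → Set
Tendsto f L = ∀ (ε : ℚ) → 0ℚ < ε → ∃ λ K → ∀ k → K ≤ k → ∣ f k - L ∣ < ε

{-# OPTIONS --safe #-}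

-- Every tuple counted by g(k) is also counted by G(k), so g(k) ≤ G(k) ≤ (k+1)ⁿ, and the
-- tuples with a zero numerator number at most n(k+1)ⁿ⁻¹. Conversely, two coprime numerators
-- already make a tuple primitive, and at least a quarter of the pairs in [1,k]² are coprime:
-- the pairs sharing a divisor d ≥ 2 number at most ∑_d (k/d)² ≤ 3k²/4. Hence g(k) ≥ kⁿ/4 for
-- n ≥ 2, while for n = 1 the same count gives t(k) ≥ k²/8. So t(k), T(k) grow like kⁿ⁺¹ while
-- g(k+1), G(k+1) = O(kⁿ), and (G(k) − g(k))/G(k) = O(1/k) (for n = 1, G(k) = g(k) once k ≥ 2).

module Submission where

open import Defs
open import Data.Nat using (ℕ; _≤_; suc)
open import Data.Rational using (0ℚ; 1ℚ)
open import Data.Product using (_×_)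

open import Data.Nat using (zero; _+_; _*_; _∸_; _^_; _<_; _⊔_; z≤n; s≤s; z<s; _≟_; >-nonZero)
open import Data.Nat.Properties
open import Data.Nat.Divisibility using (_∣_; _∣?_; ∣⇒≤; ∣m+n∣m⇒∣n; n∣m*n)
open import Data.Nat.GCD using (gcd; gcd-comm; gcd-assoc; gcd[m,n]∣m; gcd[m,n]∣n; gcd[m,n]≡0⇒m≡0; gcd-zeroˡ; gcd-zeroʳ; gcd-identityˡ)
open import Data.Nat.Coprimality using (Coprime)
open import Data.Nat.Tactic.RingSolver using (solve-∀)
open import Algebra.Properties.CommutativeSemigroup +-commutativeSemigroup using () renaming (interchange to +-interchange)
open import Algebra.Properties.CommutativeSemigroup *-commutativeSemigroup using () renaming (interchange to *-interchange)
open import Data.Integer using (+[1+_]; -[1+_])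
import Data.Integer as ℤ
import Data.Integer.Properties as ℤ
open import Data.Rational using (mkℚ)
import Data.Rational as ℚ
import Data.Rational.Properties as ℚ
open import Data.Rational.Unnormalised using (mkℚᵘ)
import Data.Rational.Unnormalised as ℚᵘ
import Data.Rational.Unnormalised.Properties as ℚᵘ
open import Data.List using (List; []; _∷_; _++_; map; concatMap; filter; length; applyUpTo)
open import Data.List.Properties using (filter-++; filter-≐; length-++; length-applyUpTo; map-applyUpTo)
open import Data.Vec using (Vec; []; _∷_)
open import Data.Product using (∃; _,_; proj₂)
open import Data.Empty using (⊥-elim)
open import Function using (_∘_; id)
open import Relation.Nullary using (Dec; yes; no)
open import Relation.Binary.PropositionalEquality

χ : ∀ {a} {A : Set a} → Dec A → ℕ
χ (yes _) = 1
χ (no _)  = 0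

χ≤1 : ∀ {a} {A : Set a} (d : Dec A) → χ d ≤ 1
χ≤1 (yes _) = ≤-refl
χ≤1 (no _)  = z≤n

χ-yes : ∀ {a} {A : Set a} → A → (d : Dec A) → χ d ≡ 1
χ-yes _ (yes _) = refl
χ-yes a (no ¬a) = ⊥-elim (¬a a)

∑< : ℕ → (ℕ → ℕ) → ℕ
∑< zero    f = 0
∑< (suc k) f = f 0 + ∑< k (f ∘ suc)

syntax ∑< k (λ i → e) = ∑[ i < k ] e

∑-snoc : ∀ k f → ∑< (suc k) f ≡ ∑< k f + f k
∑-snoc zero    f = +-identityʳ (f 0)
∑-snoc (suc k) f = trans (cong (f 0 +_) (∑-snoc k (f ∘ suc))) (sym (+-assoc (f 0) _ _))

∑-cong : ∀ k {f h : ℕ → ℕ} → (∀ i → f i ≡ h i) → ∑< k f ≡ ∑< k h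
∑-cong zero    f≡h = refl
∑-cong (suc k) f≡h = cong₂ _+_ (f≡h 0) (∑-cong k (f≡h ∘ suc))

∑-mono-≤ : ∀ k {f h : ℕ → ℕ} → (∀ i → i < k → f i ≤ h i) → ∑< k f ≤ ∑< k h
∑-mono-≤ zero    f≤h = z≤n
∑-mono-≤ (suc k) f≤h = +-mono-≤ (f≤h 0 z<s) (∑-mono-≤ k (λ i i<k → f≤h (suc i) (s≤s i<k)))

∑-const : ∀ k c → ∑[ i < k ] c ≡ k * c
∑-const zero    c = refl
∑-const (suc k) c = cong (c +_) (∑-const k c)

∑-distrib-+ : ∀ k f h → ∑[ i < k ] (f i + h i) ≡ ∑< k f + ∑< k h
∑-distrib-+ zero    f h = refl
∑-distrib-+ (suc k) f h =
  trans (cong (f 0 + h 0 +_) (∑-distrib-+ k (f ∘ suc) (h ∘ suc))) (+-interchange (f 0) (h 0) _ _)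

∑-distribˡ : ∀ k c f → ∑[ i < k ] (c * f i) ≡ c * ∑< k f
∑-distribˡ zero    c f = sym (*-zeroʳ c)
∑-distribˡ (suc k) c f = trans (cong (c * f 0 +_) (∑-distribˡ k c (f ∘ suc))) (sym (*-distribˡ-+ c (f 0) _))

∑-comm : ∀ m n (f : ℕ → ℕ → ℕ) → ∑[ i < m ] ∑[ j < n ] f i j ≡ ∑[ j < n ] ∑[ i < m ] f i j
∑-comm zero    n f = sym (trans (∑-const n 0) (*-zeroʳ n))
∑-comm (suc m) n f =
  trans (cong (∑< n (f 0) +_) (∑-comm m n (f ∘ suc))) (sym (∑-distrib-+ n (f 0) _))

f≤∑ : ∀ k f i → i < k → f i ≤ ∑< k f
f≤∑ (suc k) f zero    _         = m≤m+n (f 0) _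
f≤∑ (suc k) f (suc i) (s≤s i<k) = ≤-trans (f≤∑ k (f ∘ suc) i i<k) (m≤n+m _ (f 0))

∑-*-∑ : ∀ k f h → ∑[ i < k ] ∑[ j < k ] (f i * h j) ≡ ∑< k f * ∑< k h
∑-*-∑ k f h = begin
  ∑[ i < k ] ∑[ j < k ] (f i * h j)  ≡⟨ ∑-cong k (λ i → ∑-distribˡ k (f i) h) ⟩
  ∑[ i < k ] (f i * ∑< k h)          ≡⟨ ∑-cong k (λ i → *-comm (f i) _) ⟩
  ∑[ i < k ] (∑< k h * f i)          ≡⟨ ∑-distribˡ k (∑< k h) f ⟩
  ∑< k h * ∑< k f                    ≡⟨ *-comm (∑< k h) _ ⟩
  ∑< k f * ∑< k h                    ∎
  where open ≡-Reasoning

∑∈ : List ℕ → (ℕ → ℕ) → ℕ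
∑∈ []      f = 0
∑∈ (a ∷ r) f = f a + ∑∈ r f

syntax ∑∈ r (λ a → e) = ∑[ a ∈ r ] e

∑∈-cong : ∀ r {f h : ℕ → ℕ} → (∀ a → f a ≡ h a) → ∑∈ r f ≡ ∑∈ r h
∑∈-cong []      f≡h = refl
∑∈-cong (a ∷ r) f≡h = cong₂ _+_ (f≡h a) (∑∈-cong r f≡h)

∑∈-mono-≤ : ∀ r {f h : ℕ → ℕ} → (∀ a → f a ≤ h a) → ∑∈ r f ≤ ∑∈ r h
∑∈-mono-≤ []      f≤h = z≤n
∑∈-mono-≤ (a ∷ r) f≤h = +-mono-≤ (f≤h a) (∑∈-mono-≤ r f≤h)

∑∈-const : ∀ r c → ∑[ a ∈ r ] c ≡ length r * c
∑∈-const []      c = refl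
∑∈-const (a ∷ r) c = cong (c +_) (∑∈-const r c)

∑∈-distrib-+ : ∀ r f h → ∑[ a ∈ r ] (f a + h a) ≡ ∑∈ r f + ∑∈ r h
∑∈-distrib-+ []      f h = refl
∑∈-distrib-+ (a ∷ r) f h = trans (cong (f a + h a +_) (∑∈-distrib-+ r f h)) (+-interchange (f a) (h a) _ _)

∑∈-distribʳ : ∀ r f c → ∑[ a ∈ r ] (f a * c) ≡ ∑∈ r f * c
∑∈-distribʳ []      f c = refl
∑∈-distribʳ (a ∷ r) f c = trans (cong (f a * c +_) (∑∈-distribʳ r f c)) (sym (*-distribʳ-+ c (f a) _))

∑∈-applyUpTo : ∀ (h f : ℕ → ℕ) k → ∑[ a ∈ applyUpTo f k ] h a ≡ ∑[ i < k ] h (f i)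
∑∈-applyUpTo h f zero    = refl
∑∈-applyUpTo h f (suc k) = cong (h (f 0) +_) (∑∈-applyUpTo h (f ∘ suc) k)

gcd-comm-left : ∀ a b c → gcd a (gcd b c) ≡ gcd b (gcd a c)
gcd-comm-left a b c =
  trans (sym (gcd-assoc a b c)) (trans (cong (λ x → gcd x c) (gcd-comm a b)) (gcd-assoc b a c))

gcdV-∷ : ∀ {n} a (v : Vec ℕ n) k → gcdV (a ∷ v) k ≡ gcdV v (gcd a k)
gcdV-∷ a []      k = refl
gcdV-∷ a (b ∷ v) k = trans (gcd-comm-left a b (gcdV v k)) (cong (gcd b) (gcdV-∷ a v k))

length-filter-singleton : ∀ {a p} {A : Set a} {P : A → Set p} (P? : ∀ x → Dec (P x)) x →
                    length (filter P? (x ∷ [])) ≡ χ (P? x)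
length-filter-singleton P? x with P? x
... | yes _ = refl
... | no _  = refl

countDen-zero : ∀ r k → countDen 0 r k ≡ χ (k ≟ 1)
countDen-zero r k = length-filter-singleton (λ (v : Vec ℕ 0) → gcdV v k ≟ 1) []

length-filter-map : ∀ {a b p} {A : Set a} {B : Set b} {P : B → Set p} (P? : ∀ y → Dec (P y)) (f : A → B) xs →
                    length (filter P? (map f xs)) ≡ length (filter (P? ∘ f) xs)
length-filter-map P? f []       = refl
length-filter-map P? f (x ∷ xs) with P? (f x)
... | yes _ = cong suc (length-filter-map P? f xs)
... | no _  = length-filter-map P? f xs

countDen-suc : ∀ n r k → countDen (suc n) r k ≡ ∑[ a ∈ r ] countDen n r (gcd a k)
countDen-suc n r k = prefixes r
  where
  coprimeTo : ∀ {m} (k′ : ℕ) (v : Vec ℕ m) → Dec (gcdV v k′ ≡ 1)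
  coprimeTo k′ v = gcdV v k′ ≟ 1

  withHead : ∀ a T → length (filter (coprimeTo k) (map (a ∷_) T)) ≡ length (filter (coprimeTo (gcd a k)) T)
  withHead a T = trans (length-filter-map (coprimeTo k) (a ∷_) T)
    (cong length (filter-≐ (coprimeTo k ∘ (a ∷_)) (coprimeTo (gcd a k))
                   ((λ {v} → subst (_≡ 1) (gcdV-∷ a v k)) , (λ {v} → subst (_≡ 1) (sym (gcdV-∷ a v k)))) T))

  prefixes : ∀ s → length (filter (coprimeTo k) (concatMap (λ a → map (a ∷_) (tuples n r)) s))
                   ≡ ∑[ a ∈ s ] countDen n r (gcd a k)
  prefixes []      = refl
  prefixes (a ∷ s) = begin
    length (filter (coprimeTo k) (map (a ∷_) (tuples n r) ++ rest))
      ≡⟨ cong length (filter-++ (coprimeTo k) (map (a ∷_) (tuples n r)) rest) ⟩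
    length (filter (coprimeTo k) (map (a ∷_) (tuples n r)) ++ filter (coprimeTo k) rest)
      ≡⟨ length-++ (filter (coprimeTo k) (map (a ∷_) (tuples n r))) ⟩
    length (filter (coprimeTo k) (map (a ∷_) (tuples n r))) + length (filter (coprimeTo k) rest)
      ≡⟨ cong₂ _+_ (withHead a (tuples n r)) (prefixes s) ⟩
    countDen n r (gcd a k) + ∑[ b ∈ s ] countDen n r (gcd b k) ∎
    where
    open ≡-Reasoning
    rest = concatMap (λ b → map (b ∷_) (tuples n r)) s

countDen-≤ : ∀ n r k → countDen n r k ≤ length r ^ n
countDen-≤ zero    r k = subst (_≤ 1) (sym (countDen-zero r k)) (χ≤1 (k ≟ 1))
countDen-≤ (suc n) r k = begin
  countDen (suc n) r k                ≡⟨ countDen-suc n r k ⟩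
  ∑[ a ∈ r ] countDen n r (gcd a k)   ≤⟨ ∑∈-mono-≤ r (λ a → countDen-≤ n r (gcd a k)) ⟩
  ∑[ a ∈ r ] (length r ^ n)           ≡⟨ ∑∈-const r _ ⟩
  length r ^ suc n                    ∎
  where open ≤-Reasoning

countDen-1 : ∀ n r → countDen n r 1 ≡ length r ^ n
countDen-1 zero    r = refl
countDen-1 (suc n) r = begin
  countDen (suc n) r 1                ≡⟨ countDen-suc n r 1 ⟩
  ∑[ a ∈ r ] countDen n r (gcd a 1)   ≡⟨ ∑∈-cong r (λ a → cong (countDen n r) (gcd-zeroʳ a)) ⟩
  ∑[ a ∈ r ] countDen n r 1           ≡⟨ ∑∈-cong r (λ _ → countDen-1 n r) ⟩
  ∑[ a ∈ r ] (length r ^ n)           ≡⟨ ∑∈-const r _ ⟩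
  length r ^ suc n                    ∎
  where open ≡-Reasoning

countDen-mono-∷ : ∀ n a r k → countDen n r k ≤ countDen n (a ∷ r) k
countDen-mono-∷ zero    a r k = ≤-refl
countDen-mono-∷ (suc n) a r k = begin
  countDen (suc n) r k                              ≡⟨ countDen-suc n r k ⟩
  ∑[ b ∈ r ] countDen n r (gcd b k)                 ≤⟨ ∑∈-mono-≤ r (λ b → countDen-mono-∷ n a r (gcd b k)) ⟩
  ∑[ b ∈ r ] countDen n (a ∷ r) (gcd b k)           ≤⟨ m≤n+m _ _ ⟩
  ∑[ b ∈ a ∷ r ] countDen n (a ∷ r) (gcd b k)       ≡⟨ countDen-suc n (a ∷ r) k ⟨
  countDen (suc n) (a ∷ r) k                        ∎
  where open ≤-Reasoning

countDen-∷-≤ : ∀ m a r k → countDen (suc m) (a ∷ r) k ≤ countDen (suc m) r k + suc m * suc (length r) ^ m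
countDen-∷-≤ zero a r k = begin
  countDen 1 (a ∷ r) k                                   ≡⟨ countDen-suc 0 (a ∷ r) k ⟩
  countDen 0 (a ∷ r) (gcd a k) + ∑[ b ∈ r ] countDen 0 r (gcd b k)
                                                        ≤⟨ +-monoˡ-≤ _ (countDen-≤ 0 (a ∷ r) (gcd a k)) ⟩
  1 + ∑[ b ∈ r ] countDen 0 r (gcd b k)                  ≡⟨ cong (1 +_) (countDen-suc 0 r k) ⟨
  1 + countDen 1 r k                                     ≡⟨ +-comm 1 _ ⟩
  countDen 1 r k + 1                                     ∎
  where open ≤-Reasoning
countDen-∷-≤ (suc m) a r k = begin
  countDen (2 + m) (a ∷ r) k
    ≡⟨ countDen-suc (suc m) (a ∷ r) k ⟩
  countDen (suc m) (a ∷ r) (gcd a k) + ∑[ b ∈ r ] countDen (suc m) (a ∷ r) (gcd b k)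
    ≤⟨ +-mono-≤ (countDen-≤ (suc m) (a ∷ r) (gcd a k)) (∑∈-mono-≤ r (λ b → countDen-∷-≤ m a r (gcd b k))) ⟩
  L ^ suc m + ∑[ b ∈ r ] (countDen (suc m) r (gcd b k) + suc m * L ^ m)
    ≡⟨ cong (L ^ suc m +_) (∑∈-distrib-+ r _ _) ⟩
  L ^ suc m + (∑[ b ∈ r ] countDen (suc m) r (gcd b k) + ∑[ b ∈ r ] (suc m * L ^ m))
    ≡⟨ cong₂ (λ x y → L ^ suc m + (x + y)) (countDen-suc (suc m) r k) (sym (∑∈-const r _)) ⟨
  L ^ suc m + (countDen (2 + m) r k + ℓ * (suc m * L ^ m))
    ≤⟨ +-monoʳ-≤ (L ^ suc m) (+-monoʳ-≤ (countDen (2 + m) r k) (*-monoˡ-≤ _ (n≤1+n ℓ))) ⟩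
  L ^ suc m + (countDen (2 + m) r k + L * (suc m * L ^ m))
    ≡⟨ rearrange (L ^ m) (countDen (2 + m) r k) L m ⟩
  countDen (2 + m) r k + (2 + m) * L ^ suc m
    ∎
  where
  open ≤-Reasoning
  ℓ = length r
  L = suc ℓ
  rearrange : ∀ p c L m → L * p + (c + L * (suc m * p)) ≡ c + (2 + m) * (L * p)
  rearrange = solve-∀

countDen₁-0∷ : ∀ r k → k ≢ 1 → countDen 1 (0 ∷ r) k ≡ countDen 1 r k
countDen₁-0∷ r k k≢1 = begin
  countDen 1 (0 ∷ r) k                                  ≡⟨ countDen-suc 0 (0 ∷ r) k ⟩
  countDen 0 (0 ∷ r) (gcd 0 k) + rest                   ≡⟨ cong (_+ rest) (countDen-zero (0 ∷ r) (gcd 0 k)) ⟩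
  χ (gcd 0 k ≟ 1) + rest                                ≡⟨ cong (_+ rest) χ[gcd[0,k]≟1]≡0 ⟩
  rest                                                  ≡⟨ countDen-suc 0 r k ⟨
  countDen 1 r k                                        ∎
  where
  open ≡-Reasoning
  rest = ∑[ b ∈ r ] countDen 0 r (gcd b k)
  χ[gcd[0,k]≟1]≡0 : χ (gcd 0 k ≟ 1) ≡ 0
  χ[gcd[0,k]≟1]≡0 with gcd 0 k ≟ 1
  ... | yes gcd≡1 = ⊥-elim (k≢1 (trans (sym (gcd-identityˡ k)) gcd≡1))
  ... | no _      = refl

countDen-coprimePairs : ∀ m r k →
  (∑[ a ∈ r ] ∑[ b ∈ r ] χ (gcd a b ≟ 1)) * length r ^ m ≤ countDen (2 + m) r k
countDen-coprimePairs m r k = begin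
  (∑[ a ∈ r ] ∑[ b ∈ r ] χ (gcd a b ≟ 1)) * length r ^ m
    ≡⟨ ∑∈-distribʳ r _ _ ⟨
  ∑[ a ∈ r ] ((∑[ b ∈ r ] χ (gcd a b ≟ 1)) * length r ^ m)
    ≡⟨ ∑∈-cong r (λ a → ∑∈-distribʳ r _ _) ⟨
  ∑[ a ∈ r ] ∑[ b ∈ r ] (χ (gcd a b ≟ 1) * length r ^ m)
    ≤⟨ ∑∈-mono-≤ r (λ a → ∑∈-mono-≤ r (λ b → coprime-pair a b)) ⟩
  ∑[ a ∈ r ] ∑[ b ∈ r ] countDen m r (gcd b (gcd a k))
    ≡⟨ ∑∈-cong r (λ a → countDen-suc m r (gcd a k)) ⟨
  ∑[ a ∈ r ] countDen (suc m) r (gcd a k)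
    ≡⟨ countDen-suc (suc m) r k ⟨
  countDen (2 + m) r k
    ∎
  where
  open ≤-Reasoning
  coprime-pair : ∀ a b → χ (gcd a b ≟ 1) * length r ^ m ≤ countDen m r (gcd b (gcd a k))
  coprime-pair a b with gcd a b ≟ 1
  ... | no _      = z≤n
  ... | yes gcd≡1 = ≤-reflexive (begin-equality
    1 * length r ^ m                     ≡⟨ *-identityˡ _ ⟩
    length r ^ m                         ≡⟨ countDen-1 m r ⟨
    countDen m r 1                       ≡⟨ cong (countDen m r) (gcd-zeroˡ k) ⟨
    countDen m r (gcd 1 k)               ≡⟨ cong (λ x → countDen m r (gcd x k)) (trans (gcd-comm b a) gcd≡1) ⟨
    countDen m r (gcd (gcd b a) k)       ≡⟨ cong (countDen m r) (gcd-assoc b a k) ⟩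
    countDen m r (gcd b (gcd a k))       ∎)

g-countDen : ∀ n k → g n k ≡ countDen n (applyUpTo suc k) k
g-countDen n k = cong (λ r → countDen n r k) (map-applyUpTo id suc k)

g-≤ : ∀ n k → g n k ≤ k ^ n
g-≤ n k = begin
  g n k                                  ≡⟨ g-countDen n k ⟩
  countDen n (applyUpTo suc k) k         ≤⟨ countDen-≤ n (applyUpTo suc k) k ⟩
  length (applyUpTo suc k) ^ n           ≡⟨ cong (_^ n) (length-applyUpTo suc k) ⟩
  k ^ n                                  ∎
  where open ≤-Reasoning

G-≤ : ∀ n k → G n k ≤ suc k ^ n
G-≤ n k = subst (λ ℓ → G n k ≤ suc ℓ ^ n) (length-applyUpTo suc k) (countDen-≤ n (0 ∷ applyUpTo suc k) k)

g≤G : ∀ n k → g n k ≤ G n k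
g≤G n k = subst (_≤ G n k) (sym (g-countDen n k)) (countDen-mono-∷ n 0 (applyUpTo suc k) k)

G∸g-≤ : ∀ m k → G (suc m) k ∸ g (suc m) k ≤ suc m * suc k ^ m
G∸g-≤ m k = m≤n+o⇒m∸n≤o (G (suc m) k) (g (suc m) k) (begin
  G (suc m) k                                          ≤⟨ countDen-∷-≤ m 0 (applyUpTo suc k) k ⟩
  countDen (suc m) (applyUpTo suc k) k + suc m * suc (length (applyUpTo suc k)) ^ m
    ≡⟨ cong₂ (λ x ℓ → x + suc m * suc ℓ ^ m) (g-countDen (suc m) k) (sym (length-applyUpTo suc k)) ⟨
  g (suc m) k + suc m * suc k ^ m                      ∎)
  where open ≤-Reasoning

G₁≡g₁ : ∀ k → 2 ≤ k → G 1 k ≡ g 1 k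
G₁≡g₁ k 2≤k = trans (countDen₁-0∷ (applyUpTo suc k) k k≢1) (sym (g-countDen 1 k))
  where
  k≢1 : k ≢ 1
  k≢1 refl = <⇒≱ 2≤k ≤-refl

1≤g : ∀ n k → 1 ≤ g (suc n) (suc k)
1≤g n k = begin
  1                                      ≤⟨ m^n>0 (suc k) n ⟩
  suc k ^ n                              ≡⟨ cong (_^ n) (length-applyUpTo suc (suc k)) ⟨
  length r ^ n                           ≡⟨ countDen-1 n r ⟨
  countDen n r 1                         ≡⟨ cong (countDen n r) (gcd-zeroˡ (suc k)) ⟨
  countDen n r (gcd 1 (suc k))           ≤⟨ m≤m+n _ _ ⟩
  ∑[ a ∈ r ] countDen n r (gcd a (suc k))  ≡⟨ countDen-suc n r (suc k) ⟨
  countDen (suc n) r (suc k)             ≡⟨ g-countDen (suc n) (suc k) ⟨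
  g (suc n) (suc k)                      ∎
  where
  open ≤-Reasoning
  r = applyUpTo suc (suc k)

g₁-totient : ∀ k → g 1 k ≡ ∑[ i < k ] χ (gcd (suc i) k ≟ 1)
g₁-totient k = begin
  g 1 k                                              ≡⟨ g-countDen 1 k ⟩
  countDen 1 r k                                     ≡⟨ countDen-suc 0 r k ⟩
  ∑[ a ∈ r ] countDen 0 r (gcd a k)                  ≡⟨ ∑∈-cong r (λ a → countDen-zero r (gcd a k)) ⟩
  ∑[ a ∈ r ] χ (gcd a k ≟ 1)                         ≡⟨ ∑∈-applyUpTo (λ a → χ (gcd a k ≟ 1)) suc k ⟩
  ∑[ i < k ] χ (gcd (suc i) k ≟ 1)                   ∎
  where
  open ≡-Reasoning
  r = applyUpTo suc k

coprimePairs : ℕ → ℕ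
coprimePairs k = ∑[ i < k ] ∑[ j < k ] χ (gcd (suc i) (suc j) ≟ 1)

coprimePairs*^≤g : ∀ m k → coprimePairs k * k ^ m ≤ g (2 + m) k
coprimePairs*^≤g m k = begin
  coprimePairs k * k ^ m
    ≡⟨ cong₂ _*_ pairs (cong (_^ m) (length-applyUpTo suc k)) ⟨
  (∑[ a ∈ r ] ∑[ b ∈ r ] χ (gcd a b ≟ 1)) * length r ^ m
    ≤⟨ countDen-coprimePairs m r k ⟩
  countDen (2 + m) r k
    ≡⟨ g-countDen (2 + m) k ⟨
  g (2 + m) k
    ∎
  where
  open ≤-Reasoning
  r = applyUpTo suc k
  pairs : ∑[ a ∈ r ] ∑[ b ∈ r ] χ (gcd a b ≟ 1) ≡ coprimePairs k
  pairs = trans (∑∈-applyUpTo _ suc k) (∑-cong k (λ i → ∑∈-applyUpTo _ suc k))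

multiples : ℕ → ℕ → ℕ
multiples d k = ∑[ i < k ] χ (d ∣? suc i)

∣-<⇒+≤ : ∀ {d m n} → d ∣ m → d ∣ n → m < n → m + d ≤ n
∣-<⇒+≤ {d} {m} {n} d∣m d∣n m<n = begin
  m + d          ≤⟨ +-monoʳ-≤ m (∣⇒≤ {{>-nonZero (m<n⇒0<n∸m m<n)}} d∣n∸m) ⟩
  m + (n ∸ m)    ≡⟨ m+[n∸m]≡n (<⇒≤ m<n) ⟩
  n              ∎
  where
  open ≤-Reasoning
  d∣n∸m : d ∣ n ∸ m
  d∣n∸m = ∣m+n∣m⇒∣n (subst (d ∣_) (sym (m+[n∸m]≡n (<⇒≤ m<n))) d∣n) d∣m

multiples*≤ : ∀ d k → multiples d k * d ≤ k
multiples*≤ d zero    = z≤n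
multiples*≤ d (suc k) rewrite ∑-snoc k (λ i → χ (d ∣? suc i)) with d ∣? suc k
... | yes d∣1+k = subst (_≤ suc k)
                    (sym (trans (*-distribʳ-+ d (multiples d k) 1) (cong (multiples d k * d +_) (*-identityˡ d))))
                    (∣-<⇒+≤ (n∣m*n (multiples d k)) d∣1+k (s≤s (multiples*≤ d k)))
... | no _      = subst (_≤ suc k) (cong (_* d) (sym (+-identityʳ (multiples d k))))
                    (m≤n⇒m≤1+n (multiples*≤ d k))

dividesBoth : ℕ → ℕ → ℕ → ℕ
dividesBoth d a b = χ (d ∣? a) * χ (d ∣? b)

coprime-or-commonDivisor : ∀ k i j → i < k →
  1 ≤ χ (gcd (suc i) (suc j) ≟ 1) + ∑[ e < suc k ] dividesBoth (2 + e) (suc i) (suc j)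
coprime-or-commonDivisor k i j i<k with gcd (suc i) (suc j) ≟ 1
... | yes _   = s≤s z≤n
... | no gcd≢1 = common (gcd (suc i) (suc j)) (gcd[m,n]∣m (suc i) (suc j)) (gcd[m,n]∣n (suc i) (suc j))
                   (λ gcd≡0 → 1+n≢0 (gcd[m,n]≡0⇒m≡0 {suc i} {suc j} gcd≡0)) gcd≢1
  where
  common : ∀ d → d ∣ suc i → d ∣ suc j → d ≢ 0 → d ≢ 1 →
           1 ≤ ∑[ e < suc k ] dividesBoth (2 + e) (suc i) (suc j)
  common zero          _   _   d≢0 _   = ⊥-elim (d≢0 refl)
  common (suc zero)    _   _   _   d≢1 = ⊥-elim (d≢1 refl)
  common (suc (suc e)) d∣i d∣j _   _   = begin
    1                                                   ≡⟨ cong₂ _*_ (χ-yes d∣i (2 + e ∣? suc i)) (χ-yes d∣j (2 + e ∣? suc j)) ⟨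
    dividesBoth (2 + e) (suc i) (suc j)                 ≤⟨ f≤∑ (suc k) (λ e → dividesBoth (2 + e) (suc i) (suc j)) e e<1+k ⟩
    ∑[ e < suc k ] dividesBoth (2 + e) (suc i) (suc j)  ∎
    where
    open ≤-Reasoning
    e<1+k : e < suc k
    e<1+k = ≤-trans (n≤1+n (suc e)) (≤-trans (∣⇒≤ d∣i) (≤-trans i<k (n≤1+n k)))

square≤coprimePairs+commonMultiples : ∀ k →
  k * k ≤ coprimePairs k + ∑[ e < suc k ] (multiples (2 + e) k * multiples (2 + e) k)
square≤coprimePairs+commonMultiples k = begin
  k * k
    ≡⟨ trans (∑-cong k (λ _ → trans (∑-const k 1) (*-identityʳ k))) (∑-const k k) ⟨
  ∑[ i < k ] ∑[ j < k ] 1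
    ≤⟨ ∑-mono-≤ k (λ i i<k → ∑-mono-≤ k (λ j _ → coprime-or-commonDivisor k i j i<k)) ⟩
  ∑[ i < k ] ∑[ j < k ] (χ (gcd (suc i) (suc j) ≟ 1) + ∑[ e < suc k ] U e i j)
    ≡⟨ trans (∑-cong k (λ i → ∑-distrib-+ k _ _)) (∑-distrib-+ k _ _) ⟩
  coprimePairs k + ∑[ i < k ] ∑[ j < k ] ∑[ e < suc k ] U e i j
    ≡⟨ cong (coprimePairs k +_) (trans (∑-cong k (λ i → ∑-comm k (suc k) (λ j e → U e i j)))
                                       (∑-comm k (suc k) (λ i e → ∑[ j < k ] U e i j))) ⟩
  coprimePairs k + ∑[ e < suc k ] ∑[ i < k ] ∑[ j < k ] U e i j
    ≡⟨ cong (coprimePairs k +_) (∑-cong (suc k) (λ e → ∑-*-∑ k (multiple (2 + e)) (multiple (2 + e)))) ⟩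
  coprimePairs k + ∑[ e < suc k ] (multiples (2 + e) k * multiples (2 + e) k)
    ∎
  where
  open ≤-Reasoning
  U : ℕ → ℕ → ℕ → ℕ
  U e i j = dividesBoth (2 + e) (suc i) (suc j)
  multiple : ℕ → ℕ → ℕ
  multiple d i = χ (d ∣? suc i)

-- ∑_{e<K} 1/((2+e)(3+e)) telescopes to 1/2 − 1/(2+K).
telescoping-≤ : ∀ K (y : ℕ → ℕ) Q → (∀ e → y e * ((3 + e) * (2 + e)) ≤ Q) → 2 * (2 + K) * ∑< K y ≤ Q * K
telescoping-≤ zero    y Q y-small = z≤n
telescoping-≤ (suc K) y Q y-small = *-cancelˡ-≤ (2 + K) (begin
  (2 + K) * (2 * (3 + K) * ∑< (suc K) y)               ≡⟨ cong (λ s → (2 + K) * (2 * (3 + K) * s)) (∑-snoc K y) ⟩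
  (2 + K) * (2 * (3 + K) * (S + y K))                  ≡⟨ expand K S (y K) ⟩
  (3 + K) * (2 * (2 + K) * S) + 2 * (y K * ((3 + K) * (2 + K)))
    ≤⟨ +-mono-≤ (*-monoʳ-≤ (3 + K) (telescoping-≤ K y Q y-small)) (*-monoʳ-≤ 2 (y-small K)) ⟩
  (3 + K) * (Q * K) + 2 * Q                            ≡⟨ collect K Q ⟩
  (2 + K) * (Q * suc K)                                ∎)
  where
  open ≤-Reasoning
  S = ∑< K y
  expand : ∀ K S y → (2 + K) * (2 * (3 + K) * (S + y)) ≡ (3 + K) * (2 * (2 + K) * S) + 2 * (y * ((3 + K) * (2 + K)))
  expand = solve-∀
  collect : ∀ K Q → (3 + K) * (Q * K) + 2 * Q ≡ (2 + K) * (Q * suc K)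
  collect = solve-∀

commonMultiples-tail-≤ : ∀ k → 2 * ∑[ e < k ] (multiples (3 + e) k * multiples (3 + e) k) ≤ k * k
commonMultiples-tail-≤ zero    = z≤n
commonMultiples-tail-≤ k@(suc _) = *-cancelʳ-≤ _ _ k (begin
  2 * S * k                 ≤⟨ *-monoʳ-≤ (2 * S) (m≤n+m k 2) ⟩
  2 * S * (2 + k)           ≡⟨ reorder S k ⟩
  2 * (2 + k) * S           ≤⟨ telescoping-≤ k y (k * k) y-small ⟩
  k * k * k                 ∎)
  where
  open ≤-Reasoning
  y : ℕ → ℕ
  y e = multiples (3 + e) k * multiples (3 + e) k
  S = ∑< k y
  reorder : ∀ S k → 2 * S * (2 + k) ≡ 2 * (2 + k) * S
  reorder = solve-∀
  y-small : ∀ e → y e * ((3 + e) * (2 + e)) ≤ k * k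
  y-small e = begin
    m * m * ((3 + e) * (2 + e))  ≡⟨ regroup m e ⟩
    (m * (3 + e)) * (m * (2 + e)) ≤⟨ *-mono-≤ (multiples*≤ (3 + e) k)
                                            (≤-trans (*-monoʳ-≤ m (n≤1+n (2 + e))) (multiples*≤ (3 + e) k)) ⟩
    k * k                        ∎
    where
    m = multiples (3 + e) k
    regroup : ∀ m e → m * m * ((3 + e) * (2 + e)) ≡ (m * (3 + e)) * (m * (2 + e))
    regroup = solve-∀

square≤4*coprimePairs : ∀ k → k * k ≤ 4 * coprimePairs k
square≤4*coprimePairs k = +-cancelʳ-≤ (3 * (k * k)) _ _ (begin
  k * k + 3 * (k * k)                   ≡⟨⟩
  4 * (k * k)                           ≤⟨ *-monoʳ-≤ 4 (square≤coprimePairs+commonMultiples k) ⟩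
  4 * (P + (M₂ * M₂ + S))               ≡⟨ distribute P M₂ S ⟩
  4 * P + ((M₂ * 2) * (M₂ * 2) + 2 * (2 * S))
    ≤⟨ +-monoʳ-≤ (4 * P) (+-mono-≤ (*-mono-≤ (multiples*≤ 2 k) (multiples*≤ 2 k))
                                   (*-monoʳ-≤ 2 (commonMultiples-tail-≤ k))) ⟩
  4 * P + (k * k + 2 * (k * k))          ≡⟨⟩
  4 * P + 3 * (k * k)                   ∎)
  where
  open ≤-Reasoning
  P  = coprimePairs k
  M₂ = multiples 2 k
  S  = ∑[ e < k ] (multiples (3 + e) k * multiples (3 + e) k)
  distribute : ∀ P M S → 4 * (P + (M * M + S)) ≡ 4 * P + ((M * 2) * (M * 2) + 2 * (2 * S))
  distribute = solve-∀

^≤4*g : ∀ m k → k ^ (2 + m) ≤ 4 * g (2 + m) k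
^≤4*g m k = begin
  k ^ (2 + m)                   ≡⟨ *-assoc k k (k ^ m) ⟨
  k * k * k ^ m                 ≤⟨ *-monoˡ-≤ (k ^ m) (square≤4*coprimePairs k) ⟩
  4 * coprimePairs k * k ^ m    ≡⟨ *-assoc 4 (coprimePairs k) _ ⟩
  4 * (coprimePairs k * k ^ m)  ≤⟨ *-monoʳ-≤ 4 (coprimePairs*^≤g m k) ⟩
  4 * g (2 + m) k               ∎
  where open ≤-Reasoning

coprimePairs-suc-≤ : ∀ k → coprimePairs (suc k) ≤ coprimePairs k + 2 * g 1 (suc k)
coprimePairs-suc-≤ k = begin
  coprimePairs (suc k)
    ≡⟨ ∑-snoc k _ ⟩
  ∑[ i < k ] ∑< (suc k) (c i) + ∑< (suc k) (c k)
    ≡⟨ cong₂ _+_ (trans (∑-cong k (λ i → ∑-snoc k (c i))) (∑-distrib-+ k _ _)) (∑-snoc k (c k)) ⟩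
  (coprimePairs k + column) + (∑[ j < k ] c k j + c k k)
    ≡⟨ cong (λ row → (coprimePairs k + column) + (row + c k k)) (∑-cong k (λ j → c-comm k j)) ⟩
  (coprimePairs k + column) + (column + c k k)
    ≤⟨ m≤m+n _ (c k k) ⟩
  (coprimePairs k + column) + (column + c k k) + c k k
    ≡⟨ collect (coprimePairs k) column (c k k) ⟩
  coprimePairs k + 2 * (column + c k k)
    ≡⟨ cong (λ x → coprimePairs k + 2 * x) (trans (g₁-totient (suc k)) (∑-snoc k _)) ⟨
  coprimePairs k + 2 * g 1 (suc k)
    ∎
  where
  open ≤-Reasoning
  c : ℕ → ℕ → ℕ
  c i j = χ (gcd (suc i) (suc j) ≟ 1)
  c-comm : ∀ i j → c i j ≡ c j i
  c-comm i j = cong (λ x → χ (x ≟ 1)) (gcd-comm (suc i) (suc j))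
  column = ∑[ i < k ] c i k
  collect : ∀ p a b → (p + a) + (a + b) + b ≡ p + 2 * (a + b)
  collect = solve-∀

coprimePairs≤2*t₁ : ∀ k → coprimePairs k ≤ 2 * t 1 k
coprimePairs≤2*t₁ zero    = z≤n
coprimePairs≤2*t₁ (suc k) = begin
  coprimePairs (suc k)                     ≤⟨ coprimePairs-suc-≤ k ⟩
  coprimePairs k + 2 * g 1 (suc k)         ≤⟨ +-monoˡ-≤ _ (coprimePairs≤2*t₁ k) ⟩
  2 * t 1 k + 2 * g 1 (suc k)              ≡⟨ *-distribˡ-+ 2 (t 1 k) _ ⟨
  2 * t 1 (suc k)                          ∎
  where open ≤-Reasoning

binomial-≤ : ∀ b n → suc b ^ suc n ≤ b ^ suc n + suc n * suc b ^ n
binomial-≤ b zero    = ≤-reflexive (linear b)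
  where
  linear : ∀ b → suc b * 1 ≡ b * 1 + 1 * 1
  linear = solve-∀
binomial-≤ b (suc n) = begin
  suc b * suc b ^ suc n                                  ≤⟨ *-monoʳ-≤ (suc b) (binomial-≤ b n) ⟩
  suc b * (b ^ suc n + suc n * suc b ^ n)                ≡⟨ expand b (b ^ suc n) (suc b ^ n) n ⟩
  b * b ^ suc n + (b ^ suc n + suc n * (suc b * suc b ^ n))
    ≤⟨ +-monoʳ-≤ (b * b ^ suc n) (+-monoˡ-≤ _ (^-monoˡ-≤ (suc n) (n≤1+n b))) ⟩
  b * b ^ suc n + (suc b ^ suc n + suc n * (suc b * suc b ^ n))
    ≡⟨ cong (b * b ^ suc n +_) (collect b (suc b ^ n) n) ⟩
  b * b ^ suc n + suc (suc n) * suc b ^ suc n            ∎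
  where
  open ≤-Reasoning
  expand : ∀ b p q n → suc b * (p + suc n * q) ≡ b * p + (p + suc n * (suc b * q))
  expand = solve-∀
  collect : ∀ b q n → suc b * q + suc n * (suc b * q) ≡ suc (suc n) * (suc b * q)
  collect = solve-∀

^≤t : ∀ m k → k ^ (3 + m) ≤ 4 * (3 + m) * t (2 + m) k
^≤t m zero    = z≤n
^≤t m (suc k) = begin
  suc k ^ (3 + m)                              ≤⟨ binomial-≤ k (2 + m) ⟩
  k ^ (3 + m) + (3 + m) * suc k ^ (2 + m)      ≤⟨ +-mono-≤ (^≤t m k) (*-monoʳ-≤ (3 + m) (^≤4*g m (suc k))) ⟩
  C * t (2 + m) k + (3 + m) * (4 * g (2 + m) (suc k))  ≡⟨ collect (3 + m) (t (2 + m) k) (g (2 + m) (suc k)) ⟩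
  C * t (2 + m) (suc k)                        ∎
  where
  open ≤-Reasoning
  C = 4 * (3 + m)
  collect : ∀ a b c → 4 * a * b + a * (4 * c) ≡ 4 * a * (b + c)
  collect = solve-∀

^≤t₁ : ∀ k → k ^ 2 ≤ 8 * t 1 k
^≤t₁ k = begin
  k ^ 2                  ≡⟨ cong (k *_) (*-identityʳ k) ⟩
  k * k                  ≤⟨ square≤4*coprimePairs k ⟩
  4 * coprimePairs k     ≤⟨ *-monoʳ-≤ 4 (coprimePairs≤2*t₁ k) ⟩
  4 * (2 * t 1 k)        ≡⟨ *-assoc 4 2 (t 1 k) ⟨
  8 * t 1 k              ∎
  where open ≤-Reasoning

t-grows : ∀ n → 1 ≤ n → ∃ λ C → ∀ k → k ^ suc n ≤ C * t n k
t-grows (suc zero)    _ = 8 , ^≤t₁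
t-grows (suc (suc m)) _ = 4 * (3 + m) , ^≤t m

∣frac∣< : ∀ x b p q-1 .(c : Coprime p (suc q-1)) → x * suc q-1 < p * suc b →
          ℚ.∣ frac x (suc b) ∣ ℚ.< mkℚ (ℤ.+ p) q-1 c
∣frac∣< x b p q-1 c x/b<p/q =
  subst (ℚ._< mkℚ (ℤ.+ p) q-1 c) (sym (ℚ.0≤p⇒∣p∣≡p (ℚ.nonNegative⁻¹ _ {{ℚ.normalize-nonNeg x (suc b)}})))
    (ℚ.toℚᵘ-cancel-< (ℚᵘ.<-respˡ-≃ (ℚᵘ.≃-sym (ℚ.toℚᵘ-fromℚᵘ (mkℚᵘ (ℤ.+ x) b)))
      (ℚᵘ.*<* (subst₂ ℤ._<_ (ℤ.pos-* x (suc q-1)) (ℤ.pos-* p (suc b)) (ℤ.+<+ x/b<p/q)))))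

ratio-< : ∀ x y q p D k → x * k ≤ D * y → D * q < k → 0 < y → x * q < suc p * y
ratio-< x y q p D k xk≤Dy Dq<k y>0 = *-cancelʳ-< _ _ _ (begin-strict
  x * q * k        ≡⟨ swap x q k ⟩
  x * k * q        ≤⟨ *-monoˡ-≤ q xk≤Dy ⟩
  D * y * q        ≡⟨ regroup D y q ⟩
  y * (D * q)      <⟨ *-monoʳ-< y {{>-nonZero y>0}} Dq<k ⟩
  y * k            ≤⟨ *-monoˡ-≤ k (m≤n*m y (suc p)) ⟩
  suc p * y * k    ∎)
  where
  open ≤-Reasoning
  swap : ∀ x q k → x * q * k ≡ x * k * q
  swap = solve-∀
  regroup : ∀ D y q → D * y * q ≡ y * (D * q)
  regroup = solve-∀

frac-tendsto-0 : ∀ (x y : ℕ → ℕ) K₀ D → (∀ k → K₀ ≤ k → x k * k ≤ D * y k) →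
                 Tendsto (λ k → frac (x k) (y k)) 0ℚ
frac-tendsto-0 x y K₀ D xk≤Dy (mkℚ (ℤ.+ 0) _ _)      (ℚ.*<* (ℤ.+<+ ()))
frac-tendsto-0 x y K₀ D xk≤Dy (mkℚ -[1+ _ ] _ _)   (ℚ.*<* ())
frac-tendsto-0 x y K₀ D xk≤Dy ε@(mkℚ +[1+ p ] q-1 c) ε>0 = K₀ ⊔ suc (D * suc q-1) , small
  where
  small : ∀ k → K₀ ⊔ suc (D * suc q-1) ≤ k → ℚ.∣ frac (x k) (y k) ℚ.- 0ℚ ∣ ℚ.< ε
  small k k≥ with y k | xk≤Dy k (m⊔n≤o⇒m≤o K₀ _ k≥)
  ... | zero  | _     = ε>0
  ... | suc b | xk≤Dy′ = subst (ℚ._< ε) (cong ℚ.∣_∣ (sym (ℚ.+-identityʳ (frac (x k) (suc b)))))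
      (∣frac∣< (x k) b (suc p) q-1 c (ratio-< (x k) (suc b) (suc q-1) p D k xk≤Dy′ (m⊔n≤o⇒n≤o K₀ _ k≥) z<s))

frac-+-complement : ∀ x w b → x + w ≡ suc b → frac x (suc b) ℚ.+ frac w (suc b) ≡ 1ℚ
frac-+-complement x w b x+w≡1+b = ℚ.toℚᵘ-injective (ℚᵘ.≃-trans (ℚ.toℚᵘ-homo-+ (frac x (suc b)) (frac w (suc b)))
  (ℚᵘ.≃-trans (ℚᵘ.+-cong (ℚ.toℚᵘ-fromℚᵘ (mkℚᵘ (ℤ.+ x) b)) (ℚ.toℚᵘ-fromℚᵘ (mkℚᵘ (ℤ.+ w) b)))
    (ℚᵘ.*≡* (trans (ℤ.*-identityʳ _) (trans cross (sym (ℤ.*-identityˡ _)))))))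
  where
  cross : ℤ.+ x ℤ.* ℤ.+ suc b ℤ.+ ℤ.+ w ℤ.* ℤ.+ suc b ≡ ℤ.+ (suc b * suc b)
  cross = begin
    ℤ.+ x ℤ.* ℤ.+ suc b ℤ.+ ℤ.+ w ℤ.* ℤ.+ suc b     ≡⟨ cong₂ ℤ._+_ (ℤ.pos-* x (suc b)) (ℤ.pos-* w (suc b)) ⟨
    ℤ.+ (x * suc b) ℤ.+ ℤ.+ (w * suc b)         ≡⟨ ℤ.pos-+ (x * suc b) (w * suc b) ⟨
    ℤ.+ (x * suc b + w * suc b)               ≡⟨ cong ℤ.+_ (*-distribʳ-+ (suc b) x w) ⟨
    ℤ.+ ((x + w) * suc b)                     ≡⟨ cong (λ n → ℤ.+ (n * suc b)) x+w≡1+b ⟩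
    ℤ.+ (suc b * suc b)                       ∎
    where open ≡-Reasoning

∣frac-1∣ : ∀ x b → x ≤ suc b → ℚ.∣ frac x (suc b) ℚ.- 1ℚ ∣ ≡ ℚ.∣ frac (suc b ∸ x) (suc b) ∣
∣frac-1∣ x b x≤1+b = trans (cong ℚ.∣_∣ a-1≡-w) (ℚ.∣-p∣≡∣p∣ w)
  where
  open ≡-Reasoning
  a = frac x (suc b)
  w = frac (suc b ∸ x) (suc b)
  a-1≡-w : a ℚ.- 1ℚ ≡ ℚ.- w
  a-1≡-w = begin
    a ℚ.- 1ℚ                     ≡⟨ cong (λ u → a ℚ.- u) (frac-+-complement x (suc b ∸ x) b (m+[n∸m]≡n x≤1+b)) ⟨
    a ℚ.+ ℚ.- (a ℚ.+ w)          ≡⟨ cong (a ℚ.+_) (ℚ.neg-distrib-+ a w) ⟩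
    a ℚ.+ (ℚ.- a ℚ.+ ℚ.- w)      ≡⟨ ℚ.+-assoc a (ℚ.- a) (ℚ.- w) ⟨
    (a ℚ.- a) ℚ.+ ℚ.- w          ≡⟨ cong (ℚ._+ ℚ.- w) (ℚ.+-inverseʳ a) ⟩
    0ℚ ℚ.+ ℚ.- w                 ≡⟨ ℚ.+-identityˡ (ℚ.- w) ⟩
    ℚ.- w                        ∎

frac-tendsto-1 : ∀ (x y : ℕ → ℕ) K₀ D →
                 (∀ k → K₀ ≤ k → 1 ≤ y k × x k ≤ y k × (y k ∸ x k) * k ≤ D * y k) →
                 Tendsto (λ k → frac (x k) (y k)) 1ℚ
frac-tendsto-1 x y K₀ D h ε ε>0
  with frac-tendsto-0 (λ k → y k ∸ x k) y K₀ D (λ k k≥K₀ → proj₂ (proj₂ (h k k≥K₀))) ε ε>0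
... | K , close = K ⊔ K₀ , near
  where
  near : ∀ k → K ⊔ K₀ ≤ k → ℚ.∣ frac (x k) (y k) ℚ.- 1ℚ ∣ ℚ.< ε
  near k k≥ with y k | h k (m⊔n≤o⇒n≤o K _ k≥) | close k (m⊔n≤o⇒m≤o K _ k≥)
  ... | suc b | _ , x≤y , _ | w<ε =
    subst (ℚ._< ε) (trans (cong ℚ.∣_∣ (ℚ.+-identityʳ _)) (sym (∣frac-1∣ (x k) b x≤y))) w<ε

*-^ : ∀ a b n → (a * b) ^ n ≡ a ^ n * b ^ n
*-^ a b zero    = refl
*-^ a b (suc n) = trans (cong (a * b *_) (*-^ a b n)) (*-interchange a b (a ^ n) (b ^ n))

increment-≤ : ∀ n a c C x y k → x ≤ a * (c * k) ^ n → k ^ suc n ≤ C * y → x * k ≤ a * c ^ n * C * y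
increment-≤ n a c C x y k x≤ k^[1+n]≤Cy = begin
  x * k                       ≤⟨ *-monoˡ-≤ k x≤ ⟩
  a * (c * k) ^ n * k         ≡⟨ cong (λ z → a * z * k) (*-^ c k n) ⟩
  a * (c ^ n * k ^ n) * k     ≡⟨ regroup a (c ^ n) (k ^ n) k ⟩
  a * c ^ n * (k * k ^ n)     ≤⟨ *-monoʳ-≤ (a * c ^ n) k^[1+n]≤Cy ⟩
  a * c ^ n * (C * y)         ≡⟨ *-assoc (a * c ^ n) C y ⟨
  a * c ^ n * C * y           ∎
  where
  open ≤-Reasoning
  regroup : ∀ a p q k → a * (p * q) * k ≡ a * p * (k * q)
  regroup = solve-∀

1+k≤2k : ∀ {k} → 1 ≤ k → suc k ≤ 2 * k
1+k≤2k {k} 1≤k = begin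
  suc k       ≡⟨ +-comm 1 k ⟩
  k + 1       ≤⟨ +-monoʳ-≤ k 1≤k ⟩
  k + k       ≡⟨ cong (k +_) (+-identityʳ k) ⟨
  2 * k       ∎
  where open ≤-Reasoning

2+k≤3k : ∀ {k} → 1 ≤ k → 2 + k ≤ 3 * k
2+k≤3k 1≤k = +-mono-≤ 1≤k (1+k≤2k 1≤k)

g-suc-≤ : ∀ n k → 1 ≤ k → g n (suc k) ≤ 1 * (2 * k) ^ n
g-suc-≤ n k 1≤k = ≤-trans (g-≤ n (suc k)) (≤-trans (^-monoˡ-≤ n (1+k≤2k 1≤k)) (≤-reflexive (sym (*-identityˡ _))))

G-suc-≤ : ∀ n k → 1 ≤ k → G n (suc k) ≤ 1 * (3 * k) ^ n
G-suc-≤ n k 1≤k = ≤-trans (G-≤ n (suc k)) (≤-trans (^-monoˡ-≤ n (2+k≤3k 1≤k)) (≤-reflexive (sym (*-identityˡ _))))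

t≤T : ∀ n k → t n k ≤ T n k
t≤T n zero    = z≤n
t≤T n (suc k) = +-mono-≤ (t≤T n k) (g≤G n (suc k))

1≤G : ∀ n k → 1 ≤ k → 1 ≤ G (suc n) k
1≤G n (suc k) _ = ≤-trans (1≤g n k) (g≤G (suc n) (suc k))

g/G-tendsto-1 : ∀ n → 1 ≤ n → Tendsto (λ k → frac (g n k) (G n k)) 1ℚ
g/G-tendsto-1 (suc zero)    _ = frac-tendsto-1 (g 1) (G 1) 2 0 (λ k 2≤k →
  1≤G 0 k (<⇒≤ 2≤k) , g≤G 1 k ,
  ≤-reflexive (trans (cong (λ x → (x ∸ g 1 k) * k) (G₁≡g₁ k 2≤k)) (cong (_* k) (n∸n≡0 (g 1 k)))))
g/G-tendsto-1 (suc (suc m)) _ = frac-tendsto-1 (g n) (G n) 2 ((2 + m) * 2 ^ suc m * 4) (λ k 2≤k →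
  1≤G (suc m) k (<⇒≤ 2≤k) , g≤G n k , (begin
  (G n k ∸ g n k) * k                     ≤⟨ increment-≤ (suc m) (2 + m) 2 4 _ _ k (G∸g-≤′ k (<⇒≤ 2≤k)) (^≤4*g m k) ⟩
  (2 + m) * 2 ^ suc m * 4 * g n k         ≤⟨ *-monoʳ-≤ ((2 + m) * 2 ^ suc m * 4) (g≤G n k) ⟩
  (2 + m) * 2 ^ suc m * 4 * G n k         ∎))
  where
  open ≤-Reasoning
  n = 2 + m
  G∸g-≤′ : ∀ k → 1 ≤ k → G n k ∸ g n k ≤ (2 + m) * (2 * k) ^ suc m
  G∸g-≤′ k 1≤k = ≤-trans (G∸g-≤ (suc m) k) (*-monoʳ-≤ (2 + m) (^-monoˡ-≤ (suc m) (1+k≤2k 1≤k)))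

lemma4p1 : (n : ℕ) → 1 ≤ n →
    Tendsto (λ k → frac (g n (suc k)) (t n k)) 0ℚ
    × Tendsto (λ k → frac (G n (suc k)) (T n k)) 0ℚ
    × Tendsto (λ k → frac (g n k) (G n k)) 1ℚ
lemma4p1 n 1≤n with t-grows n 1≤n
... | C , k^[1+n]≤Ct =
    frac-tendsto-0 (λ k → g n (suc k)) (t n) 1 (1 * 2 ^ n * C) (λ k 1≤k →
      increment-≤ n 1 2 C _ _ k (g-suc-≤ n k 1≤k) (k^[1+n]≤Ct k))
  , frac-tendsto-0 (λ k → G n (suc k)) (T n) 1 (1 * 3 ^ n * C) (λ k 1≤k →
      increment-≤ n 1 3 C _ _ k (G-suc-≤ n k 1≤k) (≤-trans (k^[1+n]≤Ct k) (*-monoʳ-≤ C (t≤T n k))))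
  , g/G-tendsto-1 n 1≤n
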